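{- Let $H$ be a finite, simple, undirected, connected graph and let $G = KB(H)$ be its biclique graph. Let $b_1, b_2$ be two distinct vertices of $G$ that are false-twins in $G$ (i.e. $N_G(b_1) = N_G(b_2)$), and let $B_1, B_2$ be the bicliques of $H$ corresponding to $b_1, b_2$. Suppose that there is no edge of $H$ joining a vertex of $B_1$ to a vertex of $B_2$. Then there exists a vertex $v \in V(H)$ that is adjacent to every vertex of $B_1$ and to every vertex of $B_2$. Furthermore, $G$ contains the complete graph $K_5$ as an induced subgraph.
   Context: A biclique of a graph $H$ is a maximal (with respect to vertex inclusion) set of vertices of $H$ inducing a complete bipartite subgraph $K_{p,q}$ with $p,q \geq 1$. The biclique graph $KB(H)$ is the intersection graph of the family of all bicliques of $H$: its vertices are the bicliques of $H$, and two distinct bicliques are adjacent when they share at least one vertex. $N_G(x)$ denotes the open neighborhood of $x$ in $G$; two vertices $u,v$ are false-twins if $N(u)=N(v)$. -}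

module Defs where

open import Data.Nat using (ℕ)
open import Data.Fin using (Fin)
open import Data.Bool using (Bool; true; false)
open import Data.Fin.Subset using (Subset; _∈_; _⊆_; _⊂_)
open import Data.Product using (Σ; ∃; _×_; _,_)
open import Relation.Binary.PropositionalEquality using (_≡_; _≢_)
open import Relation.Nullary using (¬_; Dec)
open import Function.Bundles using (_⇔_)

record Graph (n : ℕ) : Set₁ where
  field
    Adj      : Fin n → Fin n → Set
    adj?     : (u v : Fin n) → Dec (Adj u v)
    adj-sym  : ∀ {u v} → Adj u v → Adj v u
    adj-irr  : ∀ {u} → ¬ Adj u u
open Graph public

data Reachable {n : ℕ} (H : Graph n) : Fin n → Fin n → Set where
  here : ∀ {u} → Reachable H u u
  step : ∀ {u v w} → Adj H u v → Reachable H v w → Reachable H u w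

Connected : {n : ℕ} → Graph n → Set
Connected {n} H = (u v : Fin n) → Reachable H u v

InducesCompleteBipartite : {n : ℕ} → Graph n → Subset n → Set
InducesCompleteBipartite {n} H S =
  Σ (Fin n → Bool) λ side →
    (∃ λ x → x ∈ S × side x ≡ true) ×
    (∃ λ y → y ∈ S × side y ≡ false) ×
    (∀ x y → x ∈ S → y ∈ S → Adj H x y ⇔ (side x ≢ side y))

IsBiclique : {n : ℕ} → Graph n → Subset n → Set
IsBiclique {n} H B =
  InducesCompleteBipartite H B ×
  (∀ (S : Subset n) → B ⊂ S → ¬ InducesCompleteBipartite H S)

-- Adjacency in the biclique graph KB(H): distinct bicliques sharing a vertex.
-- (Vertices of KB(H) are the subsets B with IsBiclique H B.)
KBAdj : {n : ℕ} → Subset n → Subset n → Set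
KBAdj B B' = B ≢ B' × ∃ λ v → v ∈ B × v ∈ B'

FalseTwinsKB : {n : ℕ} → Graph n → Subset n → Subset n → Set
FalseTwinsKB {n} H B₁ B₂ =
  ∀ (B : Subset n) → IsBiclique H B → KBAdj B B₁ ⇔ KBAdj B B₂

HasInducedK5KB : {n : ℕ} → Graph n → Set
HasInducedK5KB {n} H =
  Σ (Fin 5 → Subset n) λ f →
    (∀ i → IsBiclique H (f i)) ×
    (∀ i j → i ≢ j → KBAdj (f i) (f j))

module Submission where

-- Twinhood is used only through "every biclique meeting B₁ (other
-- than B₁) meets B₂, and vice versa".

open import Defs
open import Data.Nat using (ℕ; zero; suc; _+_; _≤_; _<_)
open import Data.Nat.Properties using (+-suc; +-monoʳ-≤; ≤-trans; <⇒≱; <-≤-trans; m≤m+n)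
open import Data.Fin using (Fin; zero; suc)
open import Data.Fin.Properties using (_≟_; all?; any?)
open import Data.Fin.Subset using (Subset; _∈_; _∉_; _⊆_; _⊂_; ⁅_⁆; _∪_; ∣_∣; Nonempty)
open import Data.Fin.Subset.Properties using (_∈?_; x∈⁅x⁆; x∈⁅y⁆⇒x≡y; p⊆p∪q; q⊆p∪q; x∈p∪q⁻; p⊂q⇒∣p∣<∣q∣; ∣p∣≤n)
open import Data.Bool using (Bool; true; false; not; _xor_; if_then_else_)
open import Data.Bool.Properties using (¬-not; not-¬; not-injective; xor-same; xor-assoc; xor-comm; xor-inverseˡ) renaming (_≟_ to _≟B_)
open import Data.Product using (Σ; ∃; _×_; _,_; proj₁; proj₂)
open import Data.Sum using (_⊎_; inj₁; inj₂)
import Data.Sum as Sum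
open import Data.Empty using (⊥-elim)
open import Function using (_∘_; id)
open import Relation.Binary.PropositionalEquality using (_≡_; _≢_; refl; sym; trans; cong; cong₂; subst; subst₂; module ≡-Reasoning)
open import Relation.Nullary using (¬_; Dec; yes; no; does)
open import Relation.Nullary.Decidable using (dec-true; dec-false; map; map′; ¬?; _×-dec_; _⊎-dec_; _→-dec_)
open import Function.Bundles using (_⇔_; mk⇔; Equivalence)
open Equivalence using (to; from)

-- Two labellings of a two-element partition that induce the same "same class"
-- relation with respect to a base point differ by a constant xor-shift.
xor-relabel : ∀ {a a₀ b b₀ : Bool} → (a ≡ a₀ → b ≡ b₀) → (b ≡ b₀ → a ≡ a₀) → b ≡ a xor (a₀ xor b₀)
xor-relabel {a} {a₀} {b} {b₀} same⇒ same⇐ with a ≟B a₀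
... | yes refl = begin
  b                ≡⟨ same⇒ refl ⟩
  b₀               ≡⟨ cong (_xor b₀) (sym (xor-same a)) ⟩
  (a xor a) xor b₀ ≡⟨ xor-assoc a a b₀ ⟩
  a xor (a xor b₀) ∎
  where open ≡-Reasoning
... | no a≢a₀ = begin
  b                       ≡⟨ ¬-not (a≢a₀ ∘ same⇐) ⟩
  not b₀                  ≡⟨ cong (_xor b₀) (sym (xor-inverseˡ a₀)) ⟩
  (not a₀ xor a₀) xor b₀  ≡⟨ xor-assoc (not a₀) a₀ b₀ ⟩
  not a₀ xor (a₀ xor b₀)  ≡⟨ cong (_xor (a₀ xor b₀)) (sym (¬-not a≢a₀)) ⟩
  a xor (a₀ xor b₀)       ∎
  where open ≡-Reasoning

xor-cancelʳ : ∀ c {a d : Bool} → a xor c ≡ d xor c → a ≡ d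
xor-cancelʳ c {a} {d} eq = cancelˡ c (trans (xor-comm c a) (trans eq (xor-comm d c)))
  where
  cancelˡ : ∀ c {a d : Bool} → c xor a ≡ c xor d → a ≡ d
  cancelˡ true  = not-injective
  cancelˡ false = id

_⇔-dec_ : ∀ {A B : Set} → Dec A → Dec B → Dec (A ⇔ B)
a? ⇔-dec b? = map (mk⇔ (λ (f , g) → mk⇔ f g) (λ e → to e , from e)) ((a? →-dec b?) ×-dec (b? →-dec a?))

∈-insert⁻ : ∀ {n} {x v : Fin n} (L : Subset n) → x ∈ ⁅ v ⁆ ∪ L → x ≡ v ⊎ x ∈ L
∈-insert⁻ {v = v} L x∈ = Sum.map₁ (x∈⁅y⁆⇒x≡y v) (x∈p∪q⁻ ⁅ v ⁆ L x∈)

∈-pair⁻ : ∀ {n} {z x y : Fin n} → z ∈ ⁅ x ⁆ ∪ ⁅ y ⁆ → z ≡ x ⊎ z ≡ y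
∈-pair⁻ {y = y} z∈ = Sum.map₂ (x∈⁅y⁆⇒x≡y y) (∈-insert⁻ ⁅ y ⁆ z∈)

KBAdj-sym : ∀ {n} {A B : Subset n} → KBAdj A B → KBAdj B A
KBAdj-sym (A≢B , x , x∈A , x∈B) = A≢B ∘ sym , x , x∈B , x∈A

corner : Fin 4 → Bool × Bool
corner zero                   = true  , true
corner (suc zero)             = true  , false
corner (suc (suc zero))       = false , true
corner (suc (suc (suc zero))) = false , false

corner-index : Bool × Bool → Fin 4
corner-index (true  , true)  = zero
corner-index (true  , false) = suc zero
corner-index (false , true)  = suc (suc zero)
corner-index (false , false) = suc (suc (suc zero))

corner-index-corner : ∀ k → corner-index (corner k) ≡ k
corner-index-corner zero                   = refl
corner-index-corner (suc zero)             = refl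
corner-index-corner (suc (suc zero))       = refl
corner-index-corner (suc (suc (suc zero))) = refl

corner-injective : ∀ {k k'} → corner k ≡ corner k' → k ≡ k'
corner-injective {k} {k'} eq =
  trans (sym (corner-index-corner k)) (trans (cong corner-index eq) (corner-index-corner k'))

module Bicliques {n : ℕ} (H : Graph n) where

  CB : Subset n → Set
  CB = InducesCompleteBipartite H

  side : ∀ {S} → CB S → Fin n → Bool
  side = proj₁

  bipartition : ∀ {S} (cb : CB S) {x y} → x ∈ S → y ∈ S → Adj H x y ⇔ (side cb x ≢ side cb y)
  bipartition (_ , _ , _ , e) = e _ _

  pick : ∀ {S} (cb : CB S) b → ∃ λ x → x ∈ S × side cb x ≡ b
  pick (_ , t , _ , _) true  = t
  pick (_ , _ , f , _) false = f

  Independent : Subset n → Set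
  Independent L = ∀ {x y} → x ∈ L → y ∈ L → ¬ Adj H x y

  Separated : Subset n → Subset n → Set
  Separated B B' = ∀ x y → x ∈ B → y ∈ B' → ¬ Adj H x y

  separated-sym : ∀ {B B'} → Separated B B' → Separated B' B
  separated-sym sep x y x∈ y∈ = sep y x y∈ x∈ ∘ adj-sym H

  nonadj⇒same-side : ∀ {S} (cb : CB S) {x y} → x ∈ S → y ∈ S → ¬ Adj H x y → side cb x ≡ side cb y
  nonadj⇒same-side cb x∈ y∈ x≁y with side cb _ ≟B side cb _
  ... | yes eq = eq
  ... | no  ne = ⊥-elim (x≁y (from (bipartition cb x∈ y∈) ne))

  same-side⇒nonadj : ∀ {S} (cb : CB S) {x y} → x ∈ S → y ∈ S → side cb x ≡ side cb y → ¬ Adj H x y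
  same-side⇒nonadj cb x∈ y∈ eq x~y = to (bipartition cb x∈ y∈) x~y eq

  common-nonneighbours : ∀ {S a b c} (cb : CB S) → a ∈ S → b ∈ S → c ∈ S
                       → ¬ Adj H c a → ¬ Adj H c b → ¬ Adj H a b
  common-nonneighbours cb a∈ b∈ c∈ c≁a c≁b =
    same-side⇒nonadj cb a∈ b∈ (trans (sym (nonadj⇒same-side cb c∈ a∈ c≁a)) (nonadj⇒same-side cb c∈ b∈ c≁b))

  adj-across : ∀ {S a c w} (cb : CB S) → a ∈ S → c ∈ S → w ∈ S
             → ¬ Adj H a c → Adj H a w → Adj H w c
  adj-across cb a∈ c∈ w∈ a≁c a~w =
    from (bipartition cb w∈ c∈)
      (λ eq → to (bipartition cb a∈ w∈) a~w (trans (nonadj⇒same-side cb a∈ c∈ a≁c) (sym eq)))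

  opposite : ∀ {S} (cb : CB S) {a} → ∃ λ z → z ∈ S × side cb a ≢ side cb z
  opposite cb {a} with pick cb (not (side cb a))
  ... | z , z∈ , sz = z , z∈ , λ eq → not-¬ refl (trans eq sz)

  separated⇒disjoint : ∀ {B B'} → CB B' → Separated B B' → ∀ {x} → x ∈ B → x ∉ B'
  separated⇒disjoint cb' sep {x} x∈ x∈' with opposite cb' {x}
  ... | z , z∈ , d = sep _ z x∈ z∈ (from (bipartition cb' x∈' z∈) d)

  star-CB : ∀ v L → (∀ x → x ∈ L → Adj H v x) → Independent L → Nonempty L → CB (⁅ v ⁆ ∪ L)
  star-CB v L v~L indep (x₀ , x₀∈) =
    isCentre , (v , p⊆p∪q L (x∈⁅x⁆ v) , centre-true) , (x₀ , q⊆p∪q ⁅ v ⁆ L x₀∈ , leaf-false x₀∈) , bip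
    where
    isCentre : Fin n → Bool
    isCentre x = does (x ≟ v)
    centre-true : isCentre v ≡ true
    centre-true = dec-true (v ≟ v) refl
    leaf-false : ∀ {x} → x ∈ L → isCentre x ≡ false
    leaf-false {x} x∈ = dec-false (x ≟ v) λ { refl → adj-irr H (v~L x x∈) }
    centre≢leaf : ∀ {y} → y ∈ L → isCentre v ≢ isCentre y
    centre≢leaf yL eq with trans (sym centre-true) (trans eq (leaf-false yL))
    ... | ()
    bip : ∀ x y → x ∈ ⁅ v ⁆ ∪ L → y ∈ ⁅ v ⁆ ∪ L → Adj H x y ⇔ (isCentre x ≢ isCentre y)
    bip x y x∈ y∈ with ∈-insert⁻ L x∈ | ∈-insert⁻ L y∈
    ... | inj₁ refl | inj₁ refl = mk⇔ (⊥-elim ∘ adj-irr H) (λ ne → ⊥-elim (ne refl))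
    ... | inj₁ refl | inj₂ yL   = mk⇔ (λ _ → centre≢leaf yL) (λ _ → v~L y yL)
    ... | inj₂ xL   | inj₁ refl = mk⇔ (λ _ → centre≢leaf xL ∘ sym) (λ _ → adj-sym H (v~L x xL))
    ... | inj₂ xL   | inj₂ yL   = mk⇔ (⊥-elim ∘ indep xL yL) (λ ne → ⊥-elim (ne (trans (leaf-false xL) (sym (leaf-false yL)))))

  Cherry : Fin n → Fin n → Fin n → Subset n
  Cherry a x y = ⁅ a ⁆ ∪ (⁅ x ⁆ ∪ ⁅ y ⁆)

  -- A path x – a – y with x ≁ y (x = y allowed: then it is an edge) is complete bipartite.
  cherry-CB : ∀ {a x y} → Adj H a x → Adj H a y → ¬ Adj H x y → CB (Cherry a x y)
  cherry-CB {a} {x} {y} a~x a~y x≁y =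
    star-CB a (⁅ x ⁆ ∪ ⁅ y ⁆) a~leaf indep (x , p⊆p∪q ⁅ y ⁆ (x∈⁅x⁆ x))
    where
    a~leaf : ∀ z → z ∈ ⁅ x ⁆ ∪ ⁅ y ⁆ → Adj H a z
    a~leaf z z∈ with ∈-pair⁻ z∈
    ... | inj₁ refl = a~x
    ... | inj₂ refl = a~y
    indep : Independent (⁅ x ⁆ ∪ ⁅ y ⁆)
    indep z∈ z'∈ with ∈-pair⁻ z∈ | ∈-pair⁻ z'∈
    ... | inj₁ refl | inj₁ refl = adj-irr H
    ... | inj₁ refl | inj₂ refl = x≁y
    ... | inj₂ refl | inj₁ refl = x≁y ∘ adj-sym H
    ... | inj₂ refl | inj₂ refl = adj-irr H

  centre∈ : ∀ a x y → a ∈ Cherry a x y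
  centre∈ a x y = p⊆p∪q (⁅ x ⁆ ∪ ⁅ y ⁆) (x∈⁅x⁆ a)

  left∈ : ∀ a x y → x ∈ Cherry a x y
  left∈ a x y = q⊆p∪q ⁅ a ⁆ _ (p⊆p∪q ⁅ y ⁆ (x∈⁅x⁆ x))

  right∈ : ∀ a x y → y ∈ Cherry a x y
  right∈ a x y = q⊆p∪q ⁅ a ⁆ _ (q⊆p∪q ⁅ x ⁆ ⁅ y ⁆ (x∈⁅x⁆ y))

  FitsOn : Subset n → (Fin n → Bool) → Fin n → Bool → Set
  FitsOn S s u b = ∀ x → x ∈ S → Adj H u x ⇔ (s x ≢ b)

  Addable : Subset n → (Fin n → Bool) → Fin n → Set
  Addable S s u = u ∉ S × ∃ (FitsOn S s u)

  addable? : ∀ S s u → Dec (Addable S s u)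
  addable? S s u = ¬? (u ∈? S) ×-dec map′ (Sum.[ (true ,_) , (false ,_) ]) fits-true-or-false (fits? true ⊎-dec fits? false)
    where
    fits? : ∀ b → Dec (FitsOn S s u b)
    fits? b = all? λ x → (x ∈? S) →-dec (adj? H u x ⇔-dec ¬? (s x ≟B b))
    fits-true-or-false : ∃ (FitsOn S s u) → FitsOn S s u true ⊎ FitsOn S s u false
    fits-true-or-false (true  , fits) = inj₁ fits
    fits-true-or-false (false , fits) = inj₂ fits

  add-vertex : ∀ {S u} (cb : CB S) → Addable S (side cb) u → CB (⁅ u ⁆ ∪ S)
  add-vertex {S} {u} cb@(s , (x₁ , x₁∈ , sx₁) , (x₀ , x₀∈ , sx₀) , _) (u∉ , b , fits) =
    s' , (x₁ , ∈S x₁∈ , trans (on-S x₁∈) sx₁) , (x₀ , ∈S x₀∈ , trans (on-S x₀∈) sx₀) , bip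
    where
    s' : Fin n → Bool
    s' x = if does (x ≟ u) then b else s x
    ∈S : ∀ {x} → x ∈ S → x ∈ ⁅ u ⁆ ∪ S
    ∈S = q⊆p∪q ⁅ u ⁆ S
    on-S : ∀ {x} → x ∈ S → s' x ≡ s x
    on-S {x} x∈ rewrite dec-false (x ≟ u) (λ { refl → u∉ x∈ }) = refl
    at-u : s' u ≡ b
    at-u rewrite dec-true (u ≟ u) refl = refl
    bip : ∀ x y → x ∈ ⁅ u ⁆ ∪ S → y ∈ ⁅ u ⁆ ∪ S → Adj H x y ⇔ (s' x ≢ s' y)
    bip x y x∈ y∈ with ∈-insert⁻ S x∈ | ∈-insert⁻ S y∈
    ... | inj₁ refl | inj₁ refl = mk⇔ (⊥-elim ∘ adj-irr H) (λ ne → ⊥-elim (ne refl))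
    ... | inj₁ refl | inj₂ yS   = subst₂ (λ p q → Adj H u y ⇔ (p ≢ q)) (sym at-u) (sym (on-S yS))
                                    (mk⇔ (λ u~y eq → to (fits y yS) u~y (sym eq)) (λ ne → from (fits y yS) (ne ∘ sym)))
    ... | inj₂ xS   | inj₁ refl = subst₂ (λ p q → Adj H x u ⇔ (p ≢ q)) (sym (on-S xS)) (sym at-u)
                                    (mk⇔ (to (fits x xS) ∘ adj-sym H) (adj-sym H ∘ from (fits x xS)))
    ... | inj₂ xS   | inj₂ yS   = subst₂ (λ p q → Adj H x y ⇔ (p ≢ q)) (sym (on-S xS)) (sym (on-S yS)) (bipartition cb xS yS)

  -- If a complete bipartite S is strictly contained in a complete bipartite S',
  -- some vertex of S' ∖ S is addable to S: S' induces the same bipartition on S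
  -- up to swapping the sides.
  addable-from-superset : ∀ {S S'} (cb : CB S) → S ⊂ S' → CB S' → ∃ (Addable S (side cb))
  addable-from-superset {S} cb@(s , (x₀ , x₀∈ , _) , _) (S⊆S' , u , u∈' , u∉) cb'@(g , _) =
    u , u∉ , g u xor shift , fits
    where
    shift : Bool
    shift = g x₀ xor s x₀
    relabel : ∀ {x} → x ∈ S → s x ≡ g x xor shift
    relabel x∈ = xor-relabel
      (nonadj⇒same-side cb x∈ x₀∈ ∘ same-side⇒nonadj cb' (S⊆S' x∈) (S⊆S' x₀∈))
      (nonadj⇒same-side cb' (S⊆S' x∈) (S⊆S' x₀∈) ∘ same-side⇒nonadj cb x∈ x₀∈)
    fits : FitsOn S s u (g u xor shift)
    fits x x∈ = mk⇔ (λ u~x eq → to (bipartition cb' u∈' (S⊆S' x∈)) u~x (sym (xor-cancelʳ shift (trans (sym (relabel x∈)) eq))))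
                    (λ ne → from (bipartition cb' u∈' (S⊆S' x∈)) (λ eq → ne (trans (relabel x∈) (cong (_xor shift) (sym eq)))))

  BicliqueAbove : Subset n → Set
  BicliqueAbove S = Σ (Subset n) λ B → IsBiclique H B × S ⊆ B

  -- Add addable vertices while there are any; when none is left the set is
  -- maximal.  The fuel bounds the number of vertices still outside S.
  grow : ∀ fuel {S} → n ≤ fuel + ∣ S ∣ → CB S → BicliqueAbove S
  grow fuel {S} bound cb with any? (addable? S (side cb))
  ... | no closed = S , (cb , λ S' S⊂S' cb' → closed (addable-from-superset cb S⊂S' cb')) , id
  ... | yes (u , add) = continue fuel bound
    where
    S⊂u∪S : S ⊂ ⁅ u ⁆ ∪ S
    S⊂u∪S = q⊆p∪q ⁅ u ⁆ S , u , p⊆p∪q S (x∈⁅x⁆ u) , proj₁ add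
    larger : ∣ S ∣ < ∣ ⁅ u ⁆ ∪ S ∣
    larger = p⊂q⇒∣p∣<∣q∣ S⊂u∪S
    continue : ∀ fuel → n ≤ fuel + ∣ S ∣ → BicliqueAbove S
    continue zero       bound = ⊥-elim (<⇒≱ (<-≤-trans larger (∣p∣≤n (⁅ u ⁆ ∪ S))) bound)
    continue (suc fuel) bound
      with grow fuel (≤-trans bound (subst (_≤ fuel + ∣ ⁅ u ⁆ ∪ S ∣) (+-suc fuel ∣ S ∣) (+-monoʳ-≤ fuel larger))) (add-vertex cb add)
    ... | B , ib , u∪S⊆B = B , ib , u∪S⊆B ∘ proj₁ S⊂u∪S

  extend : ∀ {S} → CB S → BicliqueAbove S
  extend {S} = grow n (m≤m+n n ∣ S ∣)

  Meets : Subset n → Subset n → Set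
  Meets B B' = ∀ C → IsBiclique H C → KBAdj C B → ∃ λ c → c ∈ C × c ∈ B'

  twins⇒meets : ∀ {B₁ B₂} → FalseTwinsKB H B₁ B₂ → Meets B₁ B₂ × Meets B₂ B₁
  twins⇒meets twins = (λ C ibC → proj₂ ∘ to (twins C ibC)) , (λ C ibC → proj₂ ∘ from (twins C ibC))

  module Escape {B B'} (cb : CB B) (meets : Meets B B') (sep : Separated B B') where

    -- A cherry centred in B with a leaf outside B lies in a biclique
    -- (different from B, sharing its centre) that therefore meets B'.
    cherry-meets : ∀ {a w y} → a ∈ B → w ∉ B → Adj H a w → Adj H a y → ¬ Adj H w y
                 → ∃ λ C → CB C × Cherry a w y ⊆ C × ∃ λ c → c ∈ C × c ∈ B'
    cherry-meets {a} {w} {y} a∈ w∉ a~w a~y w≁y with extend (cherry-CB a~w a~y w≁y)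
    ... | C , ibC , ⊆C = C , proj₁ ibC , ⊆C , meets C ibC (C≢B , a , ⊆C (centre∈ a w y) , a∈)
      where
      C≢B : C ≢ B
      C≢B refl = w∉ (⊆C (left∈ a w y))

    -- If w ∉ B is adjacent to a ∈ B, it is adjacent to every y ∈ B opposite to a:
    -- otherwise a cherry w – a – y meets B' in some c, a common non-neighbour of
    -- the adjacent vertices a and y inside one complete bipartite set.
    adj-opposite : ∀ {a w y} → a ∈ B → w ∉ B → Adj H a w → y ∈ B → side cb a ≢ side cb y → Adj H w y
    adj-opposite {a} {w} {y} a∈ w∉ a~w y∈ a≠y with adj? H w y | from (bipartition cb a∈ y∈) a≠y
    ... | yes w~y | _   = w~y
    ... | no  w≁y | a~y with cherry-meets a∈ w∉ a~w a~y w≁y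
    ...   | C , cbC , ⊆C , c , c∈C , c∈B' =
      ⊥-elim (common-nonneighbours cbC (⊆C (centre∈ a w y)) (⊆C (right∈ a w y)) c∈C
                (separated-sym sep c a c∈B' a∈) (separated-sym sep c y c∈B' y∈) a~y)

    -- Such a w is adjacent to all of B: vertices on a's side are reached
    -- through a vertex z of the opposite side.
    dominates : ∀ {a w} → a ∈ B → w ∉ B → Adj H a w → ∀ y → y ∈ B → Adj H w y
    dominates {a} a∈ w∉ a~w y y∈ with side cb a ≟B side cb y
    ... | no  a≠y = adj-opposite a∈ w∉ a~w y∈ a≠y
    ... | yes a=y with opposite cb {a}
    ...   | z , z∈ , a≠z = adj-opposite z∈ w∉ (adj-sym H (adj-opposite a∈ w∉ a~w z∈ a≠z)) y∈ (λ z=y → a≠z (trans a=y (sym z=y)))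

    -- Such a w also has a neighbour in B': the edge a – w extends to a
    -- biclique meeting B' in c, and c ≁ a forces c ~ w.
    reaches : ∀ {a w} → a ∈ B → w ∉ B → Adj H a w → ∃ λ c → c ∈ B' × Adj H w c
    reaches {a} {w} a∈ w∉ a~w with cherry-meets a∈ w∉ a~w a~w (adj-irr H)
    ... | C , cbC , ⊆C , c , c∈C , c∈B' =
      c , c∈B' , adj-across cbC (⊆C (centre∈ a w w)) c∈C (⊆C (left∈ a w w)) (sep a c a∈ c∈B') a~w

  CommonNeighbour : Subset n → Subset n → Set
  CommonNeighbour B₁ B₂ = ∃ λ w → (∀ x → x ∈ B₁ → Adj H w x) × (∀ y → y ∈ B₂ → Adj H w y)

  boundary-edge : ∀ {S u t} → Reachable H u t → u ∈ S → t ∉ S → ∃ λ a → ∃ λ w → a ∈ S × w ∉ S × Adj H a w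
  boundary-edge here              u∈ t∉ = ⊥-elim (t∉ u∈)
  boundary-edge {S} (step {v = v} u~v walk) u∈ t∉ with v ∈? S
  ... | yes v∈ = boundary-edge walk v∈ t∉
  ... | no  v∉ = _ , v , u∈ , v∉ , u~v

  common-dominator : ∀ {B₁ B₂} → Connected H → IsBiclique H B₁ → IsBiclique H B₂
                   → Meets B₁ B₂ → Meets B₂ B₁ → Separated B₁ B₂
                   → CommonNeighbour B₁ B₂
  common-dominator {B₁} {B₂} conn (cb₁ , _) (cb₂ , _) meets₁₂ meets₂₁ sep
    with pick cb₁ true | pick cb₂ true
  ... | x₁ , x₁∈ , _ | x₂ , x₂∈ , _
    with boundary-edge {B₁} (conn x₁ x₂) x₁∈ (separated⇒disjoint cb₁ (separated-sym sep) x₂∈)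
  ... | a , w , a∈ , w∉ , a~w with Escape.reaches cb₁ meets₁₂ sep a∈ w∉ a~w
  ... | c , c∈ , w~c =
    w , Escape.dominates cb₁ meets₁₂ sep a∈ w∉ a~w
      , Escape.dominates cb₂ meets₂₁ (separated-sym sep) c∈ (λ w∈ → sep a w a∈ w∈ a~w) (adj-sym H w~c)

  one-side : ∀ {C B' x y y'} → CB C → (cb' : CB B') → x ∈ C → (∀ z → z ∈ B' → ¬ Adj H x z)
           → y ∈ C → y ∈ B' → y' ∈ C → y' ∈ B' → side cb' y ≡ side cb' y'
  one-side cbC cb' x∈C x≁B' y∈C y∈ y'∈C y'∈ =
    nonadj⇒same-side cb' y∈ y'∈ (common-nonneighbours cbC y∈C y'∈C x∈C (x≁B' _ y∈) (x≁B' _ y'∈))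

  -- Given a common neighbour w of two separated complete bipartite sets B₁, B₂,
  -- let D(b₁, b₂) be a biclique extending the cherry x₁ – w – x₂, where x_i is
  -- a fixed vertex on side b_i of B_i.
  module CherryBicliques {B₁ B₂} (cb₁ : CB B₁) (cb₂ : CB B₂) (sep : Separated B₁ B₂)
                         {w} (w~B₁ : ∀ x → x ∈ B₁ → Adj H w x) (w~B₂ : ∀ y → y ∈ B₂ → Adj H w y) where

    rep₁ rep₂ : Bool → Fin n
    rep₁ b = proj₁ (pick cb₁ b)
    rep₂ b = proj₁ (pick cb₂ b)

    rep₁∈ : ∀ b → rep₁ b ∈ B₁
    rep₁∈ b = proj₁ (proj₂ (pick cb₁ b))
    rep₂∈ : ∀ b → rep₂ b ∈ B₂
    rep₂∈ b = proj₁ (proj₂ (pick cb₂ b))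

    rep₁-side : ∀ b → side cb₁ (rep₁ b) ≡ b
    rep₁-side b = proj₂ (proj₂ (pick cb₁ b))
    rep₂-side : ∀ b → side cb₂ (rep₂ b) ≡ b
    rep₂-side b = proj₂ (proj₂ (pick cb₂ b))

    D : (p : Bool × Bool) → BicliqueAbove (Cherry w (rep₁ (proj₁ p)) (rep₂ (proj₂ p)))
    D (b₁ , b₂) = extend (cherry-CB (w~B₁ _ (rep₁∈ b₁)) (w~B₂ _ (rep₂∈ b₂)) (sep _ _ (rep₁∈ b₁) (rep₂∈ b₂)))

    D-set : Bool × Bool → Subset n
    D-set p = proj₁ (D p)

    D-biclique : ∀ p → IsBiclique H (D-set p)
    D-biclique p = proj₁ (proj₂ (D p))

    w∈D : ∀ p → w ∈ D-set p
    w∈D p = proj₂ (proj₂ (D p)) (centre∈ _ _ _)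
    rep₁∈D : ∀ p → rep₁ (proj₁ p) ∈ D-set p
    rep₁∈D p = proj₂ (proj₂ (D p)) (left∈ _ _ _)
    rep₂∈D : ∀ p → rep₂ (proj₂ p) ∈ D-set p
    rep₂∈D p = proj₂ (proj₂ (D p)) (right∈ _ _ _)

    -- D(b₁, b₂) determines b₁ and b₂: the vertices of D(b₁', b₂') in B₁ lie on
    -- one side of B₁, since rep₂ b₂' ∈ D(b₁', b₂') has no neighbour in B₁ (and
    -- symmetrically for B₂).
    D-injective : ∀ {p q} → D-set p ≡ D-set q → p ≡ q
    D-injective {b₁ , b₂} {b₁' , b₂'} eq = cong₂ _,_
      (trans (sym (rep₁-side b₁)) (trans same-side₁ (rep₁-side b₁')))
      (trans (sym (rep₂-side b₂)) (trans same-side₂ (rep₂-side b₂')))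
      where
      q : Bool × Bool
      q = b₁' , b₂'
      cbq : CB (D-set q)
      cbq = proj₁ (D-biclique q)
      same-side₁ : side cb₁ (rep₁ b₁) ≡ side cb₁ (rep₁ b₁')
      same-side₁ = one-side cbq cb₁ (rep₂∈D q) (λ z → separated-sym sep _ z (rep₂∈ b₂'))
                     (subst (rep₁ b₁ ∈_) eq (rep₁∈D (b₁ , b₂))) (rep₁∈ b₁) (rep₁∈D q) (rep₁∈ b₁')
      same-side₂ : side cb₂ (rep₂ b₂) ≡ side cb₂ (rep₂ b₂')
      same-side₂ = one-side cbq cb₂ (rep₁∈D q) (λ z → sep _ z (rep₁∈ b₁'))
                     (subst (rep₂ b₂ ∈_) eq (rep₂∈D (b₁ , b₂))) (rep₂∈ b₂) (rep₂∈D q) (rep₂∈ b₂')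

    -- B₁ shares rep₁ with D(p), and differs from it since rep₂ ∈ B₂ is not in B₁.
    B₁-D : ∀ p → KBAdj B₁ (D-set p)
    B₁-D p = (λ eq → separated⇒disjoint cb₁ (separated-sym sep) (rep₂∈ (proj₂ p)) (subst (_ ∈_) (sym eq) (rep₂∈D p)))
           , _ , rep₁∈ (proj₁ p) , rep₁∈D p

    D-D : ∀ {p q} → p ≢ q → KBAdj (D-set p) (D-set q)
    D-D {p} {q} p≢q = p≢q ∘ D-injective , w , w∈D p , w∈D q

  -- A common neighbour of two separated bicliques B₁, B₂ yields an induced K₅
  -- in KB(H), formed by B₁ and the four bicliques D(b₁, b₂).
  K5-from-common-neighbour : ∀ {B₁ B₂} → IsBiclique H B₁ → IsBiclique H B₂ → Separated B₁ B₂
                           → CommonNeighbour B₁ B₂ → HasInducedK5KB H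
  K5-from-common-neighbour {B₁} ib₁@(cb₁ , _) (cb₂ , _) sep (w , w~B₁ , w~B₂) = K , biclique , adjacent
    where
    open CherryBicliques cb₁ cb₂ sep w~B₁ w~B₂

    K : Fin 5 → Subset n
    K zero    = B₁
    K (suc k) = D-set (corner k)

    biclique : ∀ i → IsBiclique H (K i)
    biclique zero    = ib₁
    biclique (suc k) = D-biclique (corner k)

    adjacent : ∀ i j → i ≢ j → KBAdj (K i) (K j)
    adjacent zero    zero     i≢j = ⊥-elim (i≢j refl)
    adjacent zero    (suc k)  _   = B₁-D (corner k)
    adjacent (suc k) zero     _   = KBAdj-sym (B₁-D (corner k))
    adjacent (suc k) (suc k') i≢j = D-D (i≢j ∘ cong suc ∘ corner-injective)

-- The theorem.
lemma1 : {n : ℕ} (H : Graph n) → Connected H →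
         (B₁ B₂ : Subset n) → IsBiclique H B₁ → IsBiclique H B₂ →
         B₁ ≢ B₂ → FalseTwinsKB H B₁ B₂ →
         (∀ x y → x ∈ B₁ → y ∈ B₂ → ¬ Adj H x y) →
         (∃ λ v → (∀ x → x ∈ B₁ → Adj H v x) × (∀ y → y ∈ B₂ → Adj H v y))
         × HasInducedK5KB H
lemma1 H conn B₁ B₂ ib₁ ib₂ _ twins sep = dominator , K5-from-common-neighbour ib₁ ib₂ sep dominator
  where
  open Bicliques H
  dominator : CommonNeighbour B₁ B₂
  dominator = common-dominator conn ib₁ ib₂ (proj₁ (twins⇒meets twins)) (proj₂ (twins⇒meets twins)) sep
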